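{- Fix integers $r,t \geq 2$. Let $F$ be a graph on $t$ vertices with at least two edges and no isolated vertex, such that $F$ is not the star $K_{1, t-1}$. Then for every $n$, ${\rm ex}_{r}(n,{\rm B}_{\rm ind} F) \geq {\rm ex}_{r-1}(n-1,{\rm B}_{\rm ind} F)$. In particular, ${\rm ex}_{r}(n, {\rm B}_{\rm ind} F) = \Omega({\rm ex}(n,F))$ as $n\to\infty$.
   Context: A $k$-uniform hypergraph $\mathcal H$ is a family of $k$-element subsets (edges) of a finite vertex set $V(\mathcal H)$. For a graph $F$ with vertex set $\{v_1,\dots,v_p\}$ and edge set $\{e_1,\dots,e_q\}$, $\mathcal H$ contains an induced Berge $F$ if there exist distinct vertices $W=\{w_1,\dots,w_p\}\subseteq V(\mathcal H)$ and distinct edges $f_1,\dots,f_q$ of $\mathcal H$ such that whenever $e_i=v_\alpha v_\beta$ we have $f_i\cap W=\{w_\alpha,w_\beta\}$. ${\rm ex}_k(n,{\rm B}_{\rm ind}F)$ is the maximum number of edges of a $k$-uniform hypergraph on an $n$-element vertex set with no induced Berge $F$, and ${\rm ex}(n,F)$ is the maximum number of edges in an $n$-vertex graph with no subgraph isomorphic to $F$. -}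

module Defs where

open import Data.Nat using (ℕ; _≤_; _*_)
open import Data.Fin using (Fin)
open import Data.Fin.Subset using (Subset; ∣_∣) renaming (_∈_ to _∈ₛ_)
open import Data.List using (List; length; lookup)
open import Data.List.Relation.Unary.All using (All)
open import Data.List.Relation.Unary.Unique.Propositional using (Unique)
open import Data.Product using (Σ; ∃; _×_)
open import Relation.Binary.PropositionalEquality using (_≡_)
open import Relation.Nullary using (¬_)
open import Function.Bundles using (_⇔_)
open import Function.Definitions using (Injective)

record Hypergraph (k n : ℕ) : Set where
  field
    edges   : List (Subset n)
    unique  : Unique edges
    uniform : All (λ e → ∣ e ∣ ≡ k) edges

open Hypergraph public

∥_∥ : ∀ {k n} → Hypergraph k n → ℕ
∥ H ∥ = length (edges H)

edge : ∀ {k n} (H : Hypergraph k n) → Fin ∥ H ∥ → Subset n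
edge H i = lookup (edges H) i

Graph : ℕ → Set
Graph t = Hypergraph 2 t

-- H contains an induced Berge F: distinct vertices w(v) (w injective) and
-- distinct edges f_i = edge H (g i) (g injective) with f_i ∩ W = w(e_i).
InducedBerge : ∀ {k n t} → Graph t → Hypergraph k n → Set
InducedBerge {k} {n} {t} F H =
  Σ (Fin t → Fin n) λ w → Injective _≡_ _≡_ w ×
  Σ (Fin ∥ F ∥ → Fin ∥ H ∥) λ g → Injective _≡_ _≡_ g ×
  (∀ i v → (w v ∈ₛ edge H (g i)) ⇔ (v ∈ₛ edge F i))

ContainsSubgraph : ∀ {n t} → Graph t → Graph n → Set
ContainsSubgraph {n} {t} F G =
  Σ (Fin t → Fin n) λ φ → Injective _≡_ _≡_ φ ×
  (∀ i → ∃ λ j → ∀ x → (x ∈ₛ edge G j) ⇔ (∃ λ v → v ∈ₛ edge F i × φ v ≡ x))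

IsExBind : ∀ {t} (k n : ℕ) → Graph t → ℕ → Set
IsExBind k n F m =
  (∃ λ (H : Hypergraph k n) → ¬ InducedBerge F H × ∥ H ∥ ≡ m) ×
  (∀ (H : Hypergraph k n) → ¬ InducedBerge F H → ∥ H ∥ ≤ m)

IsEx : ∀ {t} (n : ℕ) → Graph t → ℕ → Set
IsEx n F m =
  (∃ λ (G : Graph n) → ¬ ContainsSubgraph F G × ∥ G ∥ ≡ m) ×
  (∀ (G : Graph n) → ¬ ContainsSubgraph F G → ∥ G ∥ ≤ m)

NoIsolated : ∀ {t} → Graph t → Set
NoIsolated {t} F = ∀ (v : Fin t) → ∃ λ i → v ∈ₛ edge F i

IsStar : ∀ {t} → Graph t → Set
IsStar {t} F = ∃ λ (c : Fin t) → ∀ (e : Subset t) → ∣ e ∣ ≡ 2 →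
  (∃ λ i → edge F i ≡ e) ⇔ (c ∈ₛ e)

-- Coning (adding a new vertex to every edge) preserves induced-Berge-F-freeness: an induced
-- copy using the new vertex would put that vertex in every edge of F, and a vertex lying in
-- every edge of a graph without isolated vertices makes it a star. For the linear bound, delete r-2 vertices of an F-free graph,
-- losing at most (r-2)n edges (a deleted vertex has at most n neighbours), and cone r-2
-- times: ex(n,F) ≤ ex_r(n) + (r-2)n. Coning the n-r+1 singletons r-1 times gives
-- ex_r(n) ≥ n-r+1 ≥ n/2 for large n, so ex(n,F) ≤ (2r-3) ex_r(n).
module Submission where

open import Defs
open import Data.Nat using (ℕ; zero; suc; _≤_; _∸_; _*_; _+_; z≤n; s≤s)
open import Data.Nat.Properties
open import Data.Fin using (Fin; zero; suc; punchOut; fromℕ<)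
open import Data.Fin.Properties using (any?; punchOut-injective; punchIn-punchOut)
  renaming (_≟_ to _≟ᶠ_; suc-injective to suc-injectiveᶠ)
open import Data.Fin.Subset using (Subset; ∣_∣; inside; outside; ⊥; ⁅_⁆; _⊆_; Nonempty; Empty)
  renaming (_∈_ to _∈ₛ_)
open import Data.Fin.Subset.Properties
open import Data.Vec using ([]; _∷_; here; there)
open import Data.Vec.Properties using (∷-injectiveʳ)
open import Data.List using (List; []; _∷_; length; lookup; map; allFin)
open import Data.List.Properties using (length-map; length-tabulate)
open import Data.List.Membership.Propositional using (_∈_)
open import Data.List.Membership.Propositional.Properties using (∈-lookup; ∈-map⁻)
open import Data.List.Relation.Unary.All as All using (All; []; _∷_)
import Data.List.Relation.Unary.All.Properties as All
open import Data.List.Relation.Unary.AllPairs using ([]; _∷_)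
open import Data.List.Relation.Unary.Any as Any using (index)
open import Data.List.Relation.Unary.Any.Properties using (lookup-index)
open import Data.List.Relation.Unary.Unique.Propositional using (Unique)
import Data.List.Relation.Unary.Unique.Propositional.Properties as Unique
open import Data.Product using (Σ; ∃; _×_; _,_; proj₁; proj₂)
open import Data.Sum using (_⊎_; inj₁; inj₂)
open import Function using (_∘_)
open import Function.Bundles using (_⇔_; mk⇔; Equivalence)
open import Function.Construct.Composition using (_⇔-∘_)
open import Function.Definitions using (Injective)
open import Relation.Nullary using (¬_; yes; no; contradiction; ¬?)
open import Relation.Nullary.Decidable using (_×-dec_)
open import Relation.Binary.PropositionalEquality

open Equivalence using (to; from)

private
  variable
    k m n s t : ℕ
    a b : ℕ
    p q : Subset n
    x y z : Fin n

Empty⇒∣p∣≡0 : Empty p → ∣ p ∣ ≡ 0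
Empty⇒∣p∣≡0 {n} p-empty = trans (cong ∣_∣ (Empty-unique p-empty)) (∣⊥∣≡0 n)

∈⇒1≤∣p∣ : x ∈ₛ p → 1 ≤ ∣ p ∣
∈⇒1≤∣p∣ x∈p = ≤-trans (s≤s z≤n) (x∈p⇒∣p-x∣<∣p∣ x∈p)

∣p∣≡0⇒p≡⊥ : ∣ p ∣ ≡ 0 → p ≡ ⊥
∣p∣≡0⇒p≡⊥ ∣p∣≡0 =
  Empty-unique λ (x , x∈p) → contradiction (subst (1 ≤_) ∣p∣≡0 (∈⇒1≤∣p∣ x∈p)) λ ()

1≤∣p∣⇒Nonempty : 1 ≤ ∣ p ∣ → Nonempty p
1≤∣p∣⇒Nonempty {p = p} 1≤∣p∣ with nonempty? p
... | yes p-nonempty = p-nonempty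
... | no p-empty = contradiction (subst (1 ≤_) (Empty⇒∣p∣≡0 p-empty) 1≤∣p∣) λ ()

distinct⇒2≤∣p∣ : x ≢ y → x ∈ₛ p → y ∈ₛ p → 2 ≤ ∣ p ∣
distinct⇒2≤∣p∣ x≢y x∈p y∈p =
  ≤-trans (s≤s (∈⇒1≤∣p∣ (x∈p∧x≢y⇒x∈p-y y∈p (x≢y ∘ sym)))) (x∈p⇒∣p-x∣<∣p∣ x∈p)

distinct⇒3≤∣p∣ : x ≢ y → x ≢ z → y ≢ z → x ∈ₛ p → y ∈ₛ p → z ∈ₛ p → 3 ≤ ∣ p ∣
distinct⇒3≤∣p∣ x≢y x≢z y≢z x∈p y∈p z∈p =
  ≤-trans (s≤s (distinct⇒2≤∣p∣ y≢z (x∈p∧x≢y⇒x∈p-y y∈p (x≢y ∘ sym))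
                                    (x∈p∧x≢y⇒x∈p-y z∈p (x≢z ∘ sym))))
          (x∈p⇒∣p-x∣<∣p∣ x∈p)

∈-other : 2 ≤ ∣ p ∣ → ∃ λ y → y ≢ x × y ∈ₛ p
∈-other {p = p} {x} 2≤∣p∣ with any? (λ y → ¬? (y ≟ᶠ x) ×-dec (y ∈? p))
... | yes other = other
... | no ¬other =
  contradiction (≤-trans 2≤∣p∣ (≤-trans (p⊆q⇒∣p∣≤∣q∣ p⊆⁅x⁆) (≤-reflexive (∣⁅x⁆∣≡1 x)))) λ { (s≤s ()) }
  where
  p⊆⁅x⁆ : p ⊆ ⁅ x ⁆
  p⊆⁅x⁆ {y} y∈p with y ≟ᶠ x
  ... | yes refl = x∈⁅x⁆ x
  ... | no y≢x = contradiction (y , y≢x , y∈p) ¬other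

2≤∣p∣⇒distinct : 2 ≤ ∣ p ∣ → ∃ λ x → ∃ λ y → x ≢ y × x ∈ₛ p × y ∈ₛ p
2≤∣p∣⇒distinct 2≤∣p∣ with 1≤∣p∣⇒Nonempty (≤-trans (s≤s z≤n) 2≤∣p∣)
... | x , x∈p with ∈-other {x = x} 2≤∣p∣
... | y , y≢x , y∈p = x , y , y≢x ∘ sym , x∈p , y∈p

∈-pair : ∣ p ∣ ≤ 2 → x ≢ y → x ∈ₛ p → y ∈ₛ p → z ∈ₛ p → z ≡ x ⊎ z ≡ y
∈-pair {x = x} {y} {z} ∣p∣≤2 x≢y x∈p y∈p z∈p with z ≟ᶠ x | z ≟ᶠ y
... | yes z≡x | _ = inj₁ z≡x
... | no _ | yes z≡y = inj₂ z≡y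
... | no z≢x | no z≢y =
  contradiction (≤-trans (distinct⇒3≤∣p∣ x≢y (z≢x ∘ sym) (z≢y ∘ sym) x∈p y∈p z∈p) ∣p∣≤2)
                λ { (s≤s (s≤s ())) }

pair-⊆ : ∣ p ∣ ≤ 2 → x ≢ y → x ∈ₛ p → y ∈ₛ p → x ∈ₛ q → y ∈ₛ q → p ⊆ q
pair-⊆ ∣p∣≤2 x≢y x∈p y∈p x∈q y∈q z∈p with ∈-pair ∣p∣≤2 x≢y x∈p y∈p z∈p
... | inj₁ refl = x∈q
... | inj₂ refl = y∈q

pair-≡ : ∣ p ∣ ≤ 2 → ∣ q ∣ ≤ 2 → x ≢ y →
         x ∈ₛ p → y ∈ₛ p → x ∈ₛ q → y ∈ₛ q → p ≡ q
pair-≡ ∣p∣≤2 ∣q∣≤2 x≢y x∈p y∈p x∈q y∈q =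
  ⊆-antisym (pair-⊆ ∣p∣≤2 x≢y x∈p y∈p x∈q y∈q) (pair-⊆ ∣q∣≤2 x≢y x∈q y∈q x∈p y∈p)

lookup-injective : ∀ {A : Set} {xs : List A} → Unique xs → Injective _≡_ _≡_ (lookup xs)
lookup-injective (_ ∷ _) {zero} {zero} _ = refl
lookup-injective (x∉xs ∷ _) {zero} {suc j} x≡xs[j] = contradiction x≡xs[j] (All.lookup x∉xs (∈-lookup j))
lookup-injective (x∉xs ∷ _) {suc i} {zero} xs[i]≡x = contradiction (sym xs[i]≡x) (All.lookup x∉xs (∈-lookup i))
lookup-injective (_ ∷ xs-unique) {suc i} {suc j} xs[i]≡xs[j] = cong suc (lookup-injective xs-unique xs[i]≡xs[j])

Unique-All≡⇒length≤1 : ∀ {A : Set} {xs : List A} {x : A} → Unique xs → All (_≡ x) xs → length xs ≤ 1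
Unique-All≡⇒length≤1 [] [] = z≤n
Unique-All≡⇒length≤1 (_ ∷ []) (_ ∷ []) = s≤s z≤n
Unique-All≡⇒length≤1 ((y≢z ∷ _) ∷ _) (y≡x ∷ z≡x ∷ _) = contradiction (trans y≡x (sym z≡x)) y≢z

∣edge∣≡k : (H : Hypergraph k n) (i : Fin ∥ H ∥) → ∣ edge H i ∣ ≡ k
∣edge∣≡k H i = All.lookup (uniform H) (∈-lookup i)

no-vertices⇒∥H∥≡0 : (H : Hypergraph (suc k) 0) → ∥ H ∥ ≡ 0
no-vertices⇒∥H∥≡0 H with edges H | uniform H
... | [] | _ = refl
... | [] ∷ _ | () ∷ _

0-uniform⇒∥H∥≤1 : (H : Hypergraph 0 n) → ∥ H ∥ ≤ 1
0-uniform⇒∥H∥≤1 H = Unique-All≡⇒length≤1 (unique H) (All.map ∣p∣≡0⇒p≡⊥ (uniform H))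

-- Edges given by membership in L rather than by index, so that copies can be moved along maps
-- of edge lists.
InducedBerge∈ : Graph t → List (Subset n) → Set
InducedBerge∈ {t} {n} F L =
  Σ (Fin t → Fin n) λ w → Injective _≡_ _≡_ w ×
  Σ (Fin ∥ F ∥ → Subset n) λ f → Injective _≡_ _≡_ f × (∀ i → f i ∈ L) ×
  (∀ i v → (w v ∈ₛ f i) ⇔ (v ∈ₛ edge F i))

cone : Hypergraph k n → Hypergraph (suc k) (suc n)
cone H = record
  { edges   = map (inside ∷_) (edges H)
  ; unique  = Unique.map⁺ ∷-injectiveʳ (unique H)
  ; uniform = All.map⁺ (All.map (cong suc) (uniform H))
  }

∥cone∥ : (H : Hypergraph k n) → ∥ cone H ∥ ≡ ∥ H ∥
∥cone∥ H = length-map _ (edges H)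

cone^ : ∀ s → Hypergraph k n → Hypergraph (s + k) (s + n)
cone^ zero    H = H
cone^ (suc s) H = cone (cone^ s H)

∥cone^∥ : ∀ s (H : Hypergraph k n) → ∥ cone^ s H ∥ ≡ ∥ H ∥
∥cone^∥ zero    H = refl
∥cone^∥ (suc s) H = trans (∥cone∥ (cone^ s H)) (∥cone^∥ s H)

outsideTails insideTails : List (Subset (suc n)) → List (Subset n)
outsideTails []                  = []
outsideTails ((outside ∷ e) ∷ L) = e ∷ outsideTails L
outsideTails ((inside ∷ e) ∷ L)  = outsideTails L
insideTails []                  = []
insideTails ((outside ∷ e) ∷ L) = insideTails L
insideTails ((inside ∷ e) ∷ L)  = e ∷ insideTails L

module _ {P : Subset (suc n) → Set} where

  All-outsideTails : ∀ {L} → All P L → All (P ∘ (outside ∷_)) (outsideTails L)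
  All-outsideTails {L = []}                  []         = []
  All-outsideTails {L = (outside ∷ e) ∷ L} (Pe ∷ PL) = Pe ∷ All-outsideTails PL
  All-outsideTails {L = (inside ∷ e) ∷ L}  (_ ∷ PL)  = All-outsideTails PL

  All-insideTails : ∀ {L} → All P L → All (P ∘ (inside ∷_)) (insideTails L)
  All-insideTails {L = []}                  []         = []
  All-insideTails {L = (outside ∷ e) ∷ L} (_ ∷ PL)  = All-insideTails PL
  All-insideTails {L = (inside ∷ e) ∷ L}  (Pe ∷ PL) = Pe ∷ All-insideTails PL

Unique-outsideTails : {L : List (Subset (suc n))} → Unique L → Unique (outsideTails L)
Unique-outsideTails {L = []} [] = []
Unique-outsideTails {L = (outside ∷ e) ∷ L} (e∉L ∷ L-unique) =
  All.map (_∘ cong (outside ∷_)) (All-outsideTails e∉L) ∷ Unique-outsideTails L-unique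
Unique-outsideTails {L = (inside ∷ e) ∷ L} (_ ∷ L-unique) = Unique-outsideTails L-unique

Unique-insideTails : {L : List (Subset (suc n))} → Unique L → Unique (insideTails L)
Unique-insideTails {L = []} [] = []
Unique-insideTails {L = (outside ∷ e) ∷ L} (_ ∷ L-unique) = Unique-insideTails L-unique
Unique-insideTails {L = (inside ∷ e) ∷ L} (e∉L ∷ L-unique) =
  All.map (_∘ cong (inside ∷_)) (All-insideTails e∉L) ∷ Unique-insideTails L-unique

length-tails : (L : List (Subset (suc n))) → length L ≡ length (outsideTails L) + length (insideTails L)
length-tails [] = refl
length-tails ((outside ∷ e) ∷ L) = cong suc (length-tails L)
length-tails ((inside ∷ e) ∷ L) =
  trans (cong suc (length-tails L)) (sym (+-suc (length (outsideTails L)) (length (insideTails L))))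

∈-outsideTails⁻ : {L : List (Subset (suc n))} {e : Subset n} → e ∈ outsideTails L → (outside ∷ e) ∈ L
∈-outsideTails⁻ {L = (outside ∷ e) ∷ L} (Any.here refl) = Any.here refl
∈-outsideTails⁻ {L = (outside ∷ e) ∷ L} (Any.there e∈L) = Any.there (∈-outsideTails⁻ e∈L)
∈-outsideTails⁻ {L = (inside ∷ e) ∷ L}  e∈L             = Any.there (∈-outsideTails⁻ e∈L)

delete : Hypergraph k (suc n) → Hypergraph k n
delete H = record
  { edges   = outsideTails (edges H)
  ; unique  = Unique-outsideTails (unique H)
  ; uniform = All-outsideTails (uniform H)
  }

link : Hypergraph (suc k) (suc n) → Hypergraph k n
link H = record
  { edges   = insideTails (edges H)
  ; unique  = Unique-insideTails (unique H)
  ; uniform = All.map suc-injective (All-insideTails (uniform H))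
  }

∥H∥≡∥delete∥+∥link∥ : (H : Hypergraph (suc k) (suc n)) → ∥ H ∥ ≡ ∥ delete H ∥ + ∥ link H ∥
∥H∥≡∥delete∥+∥link∥ H = length-tails (edges H)

1-uniform⇒∥H∥≤n : ∀ n (H : Hypergraph 1 n) → ∥ H ∥ ≤ n
1-uniform⇒∥H∥≤n zero    H = ≤-reflexive (no-vertices⇒∥H∥≡0 H)
1-uniform⇒∥H∥≤n (suc n) H = begin
  ∥ H ∥                     ≡⟨ ∥H∥≡∥delete∥+∥link∥ H ⟩
  ∥ delete H ∥ + ∥ link H ∥ ≤⟨ +-mono-≤ (1-uniform⇒∥H∥≤n n (delete H))
                                        (0-uniform⇒∥H∥≤1 (link H)) ⟩
  n + 1                     ≡⟨ +-comm n 1 ⟩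
  suc n                     ∎
  where open ≤-Reasoning

∥G∥≤∥delete∥+n : (G : Graph (suc n)) → ∥ G ∥ ≤ ∥ delete G ∥ + n
∥G∥≤∥delete∥+n {n} G = begin
  ∥ G ∥                     ≡⟨ ∥H∥≡∥delete∥+∥link∥ G ⟩
  ∥ delete G ∥ + ∥ link G ∥ ≤⟨ +-monoʳ-≤ ∥ delete G ∥ (1-uniform⇒∥H∥≤n n (link G)) ⟩
  ∥ delete G ∥ + n          ∎
  where open ≤-Reasoning

delete^ : ∀ s → Hypergraph k (s + n) → Hypergraph k n
delete^ zero    H = H
delete^ (suc s) H = delete^ s (delete H)

∥G∥≤∥delete^∥+s*n : ∀ s (G : Graph (s + n)) → ∥ G ∥ ≤ ∥ delete^ s G ∥ + s * (s + n)
∥G∥≤∥delete^∥+s*n zero G = ≤-reflexive (sym (+-identityʳ ∥ G ∥))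
∥G∥≤∥delete^∥+s*n {n} (suc s) G = begin
  ∥ G ∥                       ≤⟨ ∥G∥≤∥delete∥+n G ⟩
  ∥ delete G ∥ + (s + n)      ≤⟨ +-monoˡ-≤ (s + n) (∥G∥≤∥delete^∥+s*n s (delete G)) ⟩
  X + s * (s + n) + (s + n)   ≡⟨ +-assoc X (s * (s + n)) (s + n) ⟩
  X + (s * (s + n) + (s + n)) ≡⟨ cong (X +_) (+-comm (s * (s + n)) (s + n)) ⟩
  X + suc s * (s + n)         ≤⟨ +-monoʳ-≤ X (*-monoʳ-≤ (suc s) (n≤1+n (s + n))) ⟩
  X + suc s * suc (s + n)     ∎
  where
  open ≤-Reasoning
  X = ∥ delete^ s (delete G) ∥

singletons : ∀ n → Hypergraph 1 n
singletons n = record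
  { edges   = map ⁅_⁆ (allFin n)
  ; unique  = Unique.map⁺ ⁅⁆-injective (Unique.allFin⁺ n)
  ; uniform = All.map⁺ (All.universal ∣⁅x⁆∣≡1 (allFin n))
  }
  where
  ⁅⁆-injective : Injective _≡_ _≡_ (⁅_⁆ {n})
  ⁅⁆-injective {x} {y} ⁅x⁆≡⁅y⁆ = x∈⁅y⁆⇒x≡y y (subst (x ∈ₛ_) ⁅x⁆≡⁅y⁆ (x∈⁅x⁆ x))

∥singletons∥ : ∀ n → ∥ singletons n ∥ ≡ n
∥singletons∥ n = trans (length-map ⁅_⁆ (allFin n)) (length-tabulate _)

IsCentre : Graph t → Fin t → Set
IsCentre F c = ∀ i → c ∈ₛ edge F i

module _ {F : Graph t} where

  InducedBerge⇒InducedBerge∈ : (H : Hypergraph k n) → InducedBerge F H → InducedBerge∈ F (edges H)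
  InducedBerge⇒InducedBerge∈ H (w , w-inj , g , g-inj , w∈g⇔) =
    w , w-inj , edge H ∘ g , g-inj ∘ lookup-injective (unique H) , ∈-lookup ∘ g , w∈g⇔

  InducedBerge∈⇒InducedBerge : (H : Hypergraph k n) → InducedBerge∈ F (edges H) → InducedBerge F H
  InducedBerge∈⇒InducedBerge H (w , w-inj , f , f-inj , f∈ , w∈f⇔) =
    w , w-inj , g , g-inj ,
    λ i v → subst (λ e → (w v ∈ₛ e) ⇔ (v ∈ₛ edge F i)) (f≡edge∘g i) (w∈f⇔ i v)
    where
    g : Fin ∥ F ∥ → Fin ∥ H ∥
    g = index ∘ f∈
    f≡edge∘g : ∀ i → f i ≡ edge H (g i)
    f≡edge∘g i = lookup-index (f∈ i)
    g-inj : Injective _≡_ _≡_ g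
    g-inj {i} {j} gi≡gj = f-inj (trans (f≡edge∘g i) (trans (cong (edge H) gi≡gj) (sym (f≡edge∘g j))))

  centre⇒IsStar : ∀ {c} → NoIsolated F → IsCentre F c → IsStar F
  centre⇒IsStar {c} no-isolated c-centre =
    c , λ e ∣e∣≡2 → mk⇔ (λ { (i , refl) → c-centre i }) (edge-through e ∣e∣≡2)
    where
    edge-through : ∀ e → ∣ e ∣ ≡ 2 → c ∈ₛ e → ∃ λ i → edge F i ≡ e
    edge-through e ∣e∣≡2 c∈e with ∈-other {x = c} (≤-reflexive (sym ∣e∣≡2))
    ... | u , u≢c , u∈e with no-isolated u
    ... | i , u∈Fi =
      i , pair-≡ (≤-reflexive (∣edge∣≡k F i)) (≤-reflexive ∣e∣≡2) (u≢c ∘ sym) (c-centre i) u∈Fi c∈e u∈e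

  InducedBerge∈-cone⁻ : {L : List (Subset n)} → (∀ c → ¬ IsCentre F c) →
    InducedBerge∈ F (map (inside ∷_) L) → InducedBerge∈ F L
  InducedBerge∈-cone⁻ {n} {L} no-centre (w , w-inj , f , f-inj , f∈ , w∈f⇔) with any? (λ v → zero ≟ᶠ w v)
  ... | yes (c , 0≡wc) = contradiction (λ i → to (w∈f⇔ i c) (subst (_∈ₛ f i) 0≡wc (0∈f i))) (no-centre c)
    where
    0∈f : ∀ i → zero ∈ₛ f i
    0∈f i with ∈-map⁻ (inside ∷_) (f∈ i)
    ... | _ , _ , fi≡0∷e = subst (zero ∈ₛ_) (sym fi≡0∷e) here
  ... | no 0∉w = w′ , w′-inj , f′ , f′-inj , f′∈ , w′∈f′⇔
    where
    0≢w : ∀ v → zero ≢ w v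
    0≢w v 0≡wv = 0∉w (v , 0≡wv)
    w′ : Fin t → Fin n
    w′ v = punchOut (0≢w v)
    w′-inj : Injective _≡_ _≡_ w′
    w′-inj {u} {v} = w-inj ∘ punchOut-injective (0≢w u) (0≢w v)
    tail-of : ∀ i → ∃ λ e → e ∈ L × f i ≡ inside ∷ e
    tail-of i = ∈-map⁻ (inside ∷_) (f∈ i)
    f′ : Fin ∥ F ∥ → Subset n
    f′ = proj₁ ∘ tail-of
    f′∈ : ∀ i → f′ i ∈ L
    f′∈ = proj₁ ∘ proj₂ ∘ tail-of
    f≡0∷f′ : ∀ i → f i ≡ inside ∷ f′ i
    f≡0∷f′ = proj₂ ∘ proj₂ ∘ tail-of
    f′-inj : Injective _≡_ _≡_ f′
    f′-inj {i} {j} f′i≡f′j = f-inj (trans (f≡0∷f′ i) (trans (cong (inside ∷_) f′i≡f′j) (sym (f≡0∷f′ j))))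
    w′∈f′⇔ : ∀ i v → (w′ v ∈ₛ f′ i) ⇔ (v ∈ₛ edge F i)
    w′∈f′⇔ i v =
      subst₂ (λ x e → (x ∈ₛ e) ⇔ (v ∈ₛ edge F i)) (sym (punchIn-punchOut (0≢w v))) (f≡0∷f′ i) (w∈f⇔ i v)
      ⇔-∘ mk⇔ there drop-there

  ¬InducedBerge-cone : (∀ c → ¬ IsCentre F c) → (H : Hypergraph k n) →
    ¬ InducedBerge F H → ¬ InducedBerge F (cone H)
  ¬InducedBerge-cone no-centre H H-free =
    H-free ∘ InducedBerge∈⇒InducedBerge H ∘ InducedBerge∈-cone⁻ no-centre
           ∘ InducedBerge⇒InducedBerge∈ (cone H)

  ¬InducedBerge-cone^ : (∀ c → ¬ IsCentre F c) → ∀ s (H : Hypergraph k n) →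
    ¬ InducedBerge F H → ¬ InducedBerge F (cone^ s H)
  ¬InducedBerge-cone^ no-centre zero    H H-free = H-free
  ¬InducedBerge-cone^ no-centre (suc s) H H-free =
    ¬InducedBerge-cone no-centre (cone^ s H) (¬InducedBerge-cone^ no-centre s H H-free)

  InducedBerge∈-delete⁻ : {L : List (Subset (suc n))} → InducedBerge∈ F (outsideTails L) → InducedBerge∈ F L
  InducedBerge∈-delete⁻ (w , w-inj , f , f-inj , f∈ , w∈f⇔) =
    suc ∘ w , w-inj ∘ suc-injectiveᶠ ,
    (outside ∷_) ∘ f , f-inj ∘ ∷-injectiveʳ , ∈-outsideTails⁻ ∘ f∈ ,
    λ i v → w∈f⇔ i v ⇔-∘ mk⇔ drop-there there

  ¬InducedBerge-delete^ : ∀ s (H : Hypergraph k (s + n)) → ¬ InducedBerge F H → ¬ InducedBerge F (delete^ s H)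
  ¬InducedBerge-delete^ zero    H H-free = H-free
  ¬InducedBerge-delete^ (suc s) H H-free = ¬InducedBerge-delete^ s (delete H)
    (H-free ∘ InducedBerge∈⇒InducedBerge H ∘ InducedBerge∈-delete⁻ ∘ InducedBerge⇒InducedBerge∈ (delete H))

  InducedBerge⇒ContainsSubgraph : (G : Graph n) → InducedBerge F G → ContainsSubgraph F G
  InducedBerge⇒ContainsSubgraph G (w , w-inj , g , _ , w∈g⇔) =
    w , w-inj , λ i → g i , λ x →
      mk⇔ (into i x) λ (v , v∈Fi , wv≡x) → subst (_∈ₛ edge G (g i)) wv≡x (from (w∈g⇔ i v) v∈Fi)
    where
    into : ∀ i x → x ∈ₛ edge G (g i) → ∃ λ v → v ∈ₛ edge F i × w v ≡ x
    into i x x∈Gi with 2≤∣p∣⇒distinct (≤-reflexive (sym (∣edge∣≡k F i)))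
    ... | a , b , a≢b , a∈Fi , b∈Fi
      with ∈-pair (≤-reflexive (∣edge∣≡k G (g i))) (a≢b ∘ w-inj)
                  (from (w∈g⇔ i a) a∈Fi) (from (w∈g⇔ i b) b∈Fi) x∈Gi
    ... | inj₁ x≡wa = a , a∈Fi , sym x≡wa
    ... | inj₂ x≡wb = b , b∈Fi , sym x≡wb

  ¬InducedBerge-1-uniform : Fin ∥ F ∥ → (H : Hypergraph 1 n) → ¬ InducedBerge F H
  ¬InducedBerge-1-uniform i H (w , w-inj , g , _ , w∈g⇔)
    with 2≤∣p∣⇒distinct (≤-reflexive (sym (∣edge∣≡k F i)))
  ... | a , b , a≢b , a∈Fi , b∈Fi =
    contradiction (subst (2 ≤_) (∣edge∣≡k H (g i))
      (distinct⇒2≤∣p∣ (a≢b ∘ w-inj) (from (w∈g⇔ i a) a∈Fi) (from (w∈g⇔ i b) b∈Fi))) λ { (s≤s ()) }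

  exBind-suc-mono : (∀ c → ¬ IsCentre F c) → IsExBind k n F b → IsExBind (suc k) (suc n) F a → b ≤ a
  exBind-suc-mono {a = a} no-centre ((H , H-free , refl) , _) (_ , maximal) =
    subst (_≤ a) (∥cone∥ H) (maximal (cone H) (¬InducedBerge-cone no-centre H H-free))

  m≤exBind : (∀ c → ¬ IsCentre F c) → Fin ∥ F ∥ → IsExBind (k + 1) (k + m) F b → m ≤ b
  m≤exBind {k} {m} {b} no-centre i (_ , maximal) =
    subst (_≤ b) (trans (∥cone^∥ k S) (∥singletons∥ m))
      (maximal (cone^ k S) (¬InducedBerge-cone^ no-centre k S (¬InducedBerge-1-uniform i S)))
    where
    S = singletons m

  ∥G∥≤exBind+s*n : (∀ c → ¬ IsCentre F c) → ∀ s (G : Graph (s + n)) → ¬ ContainsSubgraph F G →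
    IsExBind (s + 2) (s + n) F b → ∥ G ∥ ≤ b + s * (s + n)
  ∥G∥≤exBind+s*n {n} {b} no-centre s G G-free (_ , maximal) =
    ≤-trans (∥G∥≤∥delete^∥+s*n s G) (+-monoˡ-≤ (s * (s + n)) ∥G′∥≤b)
    where
    G′ = delete^ s G
    G′-free : ¬ InducedBerge F G′
    G′-free = ¬InducedBerge-delete^ s G (G-free ∘ InducedBerge⇒ContainsSubgraph G)
    ∥G′∥≤b : ∥ G′ ∥ ≤ b
    ∥G′∥≤b =
      subst (_≤ b) (∥cone^∥ s G′) (maximal (cone^ s G′) (¬InducedBerge-cone^ no-centre s G′ G′-free))

  ex≤[1+2s]*exBind : (∀ c → ¬ IsCentre F c) → Fin ∥ F ∥ → suc s ≤ m →
    IsEx (s + suc m) F a → IsExBind (s + 2) (s + suc m) F b → a ≤ suc (s + s) * b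
  ex≤[1+2s]*exBind {s} {m} {b = b} no-centre i 1+s≤m ((G , G-free , refl) , _) exBind = begin
    ∥ G ∥                   ≤⟨ ∥G∥≤exBind+s*n no-centre s G G-free exBind ⟩
    b + s * (s + suc m)     ≤⟨ +-monoʳ-≤ b (*-monoʳ-≤ s n≤b+b) ⟩
    b + s * (b + b)         ≡⟨ cong (b +_) (trans (*-distribˡ-+ s b b) (sym (*-distribʳ-+ b s s))) ⟩
    suc (s + s) * b         ∎
    where
    open ≤-Reasoning
    m≤b : m ≤ b
    m≤b = m≤exBind no-centre i (subst₂ (λ k n → IsExBind k n F b) (+-suc s 1) (+-suc s m) exBind)
    n≤b+b : s + suc m ≤ b + b
    n≤b+b = begin
      s + suc m ≡⟨ +-suc s m ⟩
      suc s + m ≤⟨ +-monoˡ-≤ m 1+s≤m ⟩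
      m + m     ≤⟨ +-mono-≤ m≤b m≤b ⟩
      b + b     ∎

lemma3p1 : ∀ (r t : ℕ) → 2 ≤ r → 2 ≤ t → (F : Graph t) → 2 ≤ ∥ F ∥ → NoIsolated F → ¬ IsStar F →
    (∀ (n a b : ℕ) → IsExBind r n F a → IsExBind (r ∸ 1) (n ∸ 1) F b → b ≤ a)
    × (∃ λ (C : ℕ) → ∃ λ (N : ℕ) → ∀ (n a b : ℕ) → N ≤ n → IsEx n F a → IsExBind r n F b → a ≤ C * b)
lemma3p1 (suc (suc s)) t (s≤s (s≤s z≤n)) _ F 2≤∥F∥ no-isolated not-star =
  exBind-mono , suc (s + s) , s + suc (suc s) , ex-linear
  where
  no-centre : ∀ c → ¬ IsCentre F c
  no-centre c c-centre = not-star (centre⇒IsStar {F = F} no-isolated c-centre)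

  exBind-mono : ∀ n a b → IsExBind (suc (suc s)) n F a → IsExBind (suc s) (n ∸ 1) F b → b ≤ a
  -- n ∸ 1 truncates to 0 at n = 0, where a hypergraph has no edges.
  exBind-mono zero    a b _ ((H , _ , refl) , _) = ≤-trans (≤-reflexive (no-vertices⇒∥H∥≡0 H)) z≤n
  exBind-mono (suc n) a b exBind-a exBind-b = exBind-suc-mono {F = F} no-centre exBind-b exBind-a

  ex-linear : ∀ n a b → s + suc (suc s) ≤ n → IsEx n F a → IsExBind (suc (suc s)) n F b → a ≤ suc (s + s) * b
  ex-linear n a b N≤n ex exBind with m≤n⇒∃[o]m+o≡n N≤n
  ... | d , refl = ex≤[1+2s]*exBind {F = F} no-centre (fromℕ< 2≤∥F∥) (s≤s (m≤m+n s d))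
    (subst (λ n → IsEx n F a) (+-assoc s (suc (suc s)) d) ex)
    (subst₂ (λ k n → IsExBind k n F b) (+-comm 2 s) (+-assoc s (suc (suc s)) d) exBind)
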